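{- For $A\in\mathcal{PM}(n)$, $B\in\mathcal{PM}(m)$ and $i\in[n]$ define $$A\,\square_i\,B=\begin{pmatrix}A_{11}&\mathbb{O}&\mathbb{O}\\ \mathbb{1}_m^T\otimes A_{(i)}&B&\mathbb{O}\\ A_{21}&\mathbb{1}_m\otimes A^{(i)}&A_{22}\end{pmatrix}.$$ Then the maps $\square_i$ endow $\mathcal{PM}=\bigsqcup_{n\ge1}\mathcal{PM}(n)$ with a set operad structure, that is: (a) $A\,\square_i\,B\in\mathcal{PM}(n+m-1)$ for all $A\in\mathcal{PM}(n)$, $B\in\mathcal{PM}(m)$, $i\in[n]$; (b) for all $A\in\mathcal{PM}(n)$, $B\in\mathcal{PM}(m)$, $C\in\mathcal{PM}(k)$, $i\in[n]$, $j\in[m]$: $(A\,\square_i\,B)\,\square_{i+j-1}\,C=A\,\square_i\,(B\,\square_j\,C)$; (c) for all $A\in\mathcal{PM}(n)$, $B\in\mathcal{PM}(m)$, $C\in\mathcal{PM}(k)$ and $1\le i<j\le n$: $(A\,\square_i\,B)\,\square_{j+m-1}\,C=(A\,\square_j\,C)\,\square_i\,B$; (d) the $1\times1$ matrix $[1]$ is a unit: $[1]\,\square_1\,A=A\,\square_i\,[1]=A$ for all $A\in\mathcal{PM}(n)$, $i\in[n]$.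
   Context: A poset matrix of order $n$ is an $n\times n$ $(0,1)$-matrix $A=[a_{st}]$ that is lower triangular with all diagonal entries $1$ and transitive ($a_{st}=a_{tu}=1\Rightarrow a_{su}=1$); $\mathcal{PM}(n)$ is the set of these. $A[\alpha\mid\beta]$ is the submatrix with rows $\alpha$ and columns $\beta$, $A[\alpha]=A[\alpha\mid\alpha]$. For $A\in\mathcal{PM}(n)$ and $i\in[n]$: $A_{11}=A[\{1,\dots,i-1\}]$, $A_{22}=A[\{i+1,\dots,n\}]$, $A_{21}=A[\{i+1,\dots,n\}\mid\{1,\dots,i-1\}]$, $A_{(i)}=A[\{i\}\mid\{1,\dots,i-1\}]$ (a row vector of length $i-1$) and $A^{(i)}=A[\{i+1,\dots,n\}\mid\{i\}]$ (a column vector of length $n-i$); empty blocks are vacuous. $\mathbb{1}_m^T\otimes A_{(i)}$ is the $m\times(i-1)$ matrix all of whose rows equal $A_{(i)}$, and $\mathbb{1}_m\otimes A^{(i)}$ is the $(n-i)\times m$ matrix all of whose columns equal $A^{(i)}$. -}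

module Defs where

open import Data.Bool using (Bool; true; false)
open import Data.Nat using (ℕ; zero; suc; _+_; _∸_; _<_; _≤_; _≥_; s≤s; z≤n)
open import Data.Nat.Properties
open import Data.Fin using (Fin; toℕ; fromℕ<; cast)
open import Data.Fin.Properties using (toℕ<n)
open import Data.Product using (_×_)
open import Relation.Nullary using (yes; no; ¬_)
open import Relation.Binary.PropositionalEquality

-- An n×n (0,1)-matrix; entries indexed 0-based: (A s t) is a_{(s+1)(t+1)}.
Mat : ℕ → Set
Mat n = Fin n → Fin n → Bool

IsPosetMatrix : ∀ {n} → Mat n → Set
IsPosetMatrix {n} A =
  (∀ (s t : Fin n) → toℕ s < toℕ t → A s t ≡ false) ×
  (∀ (s : Fin n) → A s s ≡ true) ×
  (∀ (s t u : Fin n) → A s t ≡ true → A t u ≡ true → A s u ≡ true)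

-- Position of an index of A □_i B (size n + m, B of size m+1) in the block
-- decomposition: top block (rows/cols 1..i-1 of A), middle block (index of B),
-- bottom block (rows/cols i+1..n of A).
data Pos (n m : ℕ) : Set where
  top : Fin n → Pos n m
  mid : Fin (suc m) → Pos n m
  bot : Fin n → Pos n m

private
  botLemma : ∀ n m s → s < n + m → s ≥ m → s ∸ m < n
  botLemma n m s lt ge =
    subst (s ∸ m <_) (m+n∸n≡m n m) (∸-monoˡ-< lt ge)

  geLemma : ∀ m s i → ¬ (s ∸ i < suc m) → s ≥ m
  geLemma m s i nq = ≤-trans (≤-trans (n≤1+n m) (≮⇒≥ nq)) (m∸n≤m s i)

classify : ∀ {n m} → Fin n → Fin (n + m) → Pos n m
classify {n} {m} i s with toℕ s <? toℕ i
... | yes p = top (fromℕ< (<-trans p (toℕ<n i)))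
... | no _ with toℕ s ∸ toℕ i <? suc m
...   | yes q = mid (fromℕ< q)
...   | no nq = bot (fromℕ< (botLemma n m (toℕ s) (toℕ<n s) (geLemma m (toℕ s) (toℕ i) nq)))

-- A □_i B for A of size n, B of size (suc m), i ∈ [n] (0-based Fin n);
-- result has size n + (m+1) - 1 = n + m.
infixl 6 _□⟨_⟩_
_□⟨_⟩_ : ∀ {n m} → Mat n → Fin n → Mat (suc m) → Mat (n + m)
(A □⟨ i ⟩ B) s t with classify i s | classify i t
... | top a | top b = A a b
... | top _ | mid _ = false
... | top _ | bot _ = false
... | mid _ | top b = A i b
... | mid x | mid y = B x y
... | mid _ | bot _ = false
... | bot a | top b = A a b
... | bot a | mid _ = A a i
... | bot a | bot b = A a b

unitMat : Mat 1
unitMat _ _ = true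

_≋⟨_⟩_ : ∀ {n n'} → Mat n → n ≡ n' → Mat n' → Set
_≋⟨_⟩_ {n} A eq B = ∀ (s t : Fin n) → A s t ≡ B (cast eq s) (cast eq t)

-- Index i + j - 1 (1-based), i.e. i + j (0-based), in Fin (n + m), for j ∈ [m+1].
idxB : ∀ {n m} → Fin n → Fin (suc m) → Fin (n + m)
idxB {n} {m} i j =
  fromℕ< (+-mono-<-≤ (toℕ<n i) (≤-pred (toℕ<n j)))

-- Index j + (m+1) - 1 (1-based), i.e. j + m (0-based), in Fin (n + m).
idxC : ∀ {n} m → Fin n → Fin (n + m)
idxC m j = fromℕ< (+-monoˡ-< m (toℕ<n j))

idxI : ∀ {n} k → Fin n → Fin (n + k)
idxI k i = fromℕ< (<-≤-trans (toℕ<n i) (m≤m+n _ k))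

sizeAssoc : ∀ n m k → n + m + k ≡ n + (m + k)
sizeAssoc = +-assoc

sizeComm : ∀ n m k → n + m + k ≡ n + k + m
sizeComm n m k = trans (+-assoc n m k) (trans (cong (n +_) (+-comm m k)) (sym (+-assoc n k m)))

-- A □ᵢ B substitutes the poset B for the point i of A: an index of the composite is
-- either an index of A other than i or an index of B, and two indices are related by B
-- when both come from B, and otherwise by A after collapsing B to the point i.  For this
-- substitution on arbitrary index sets, associativity and the exchange law are pure case
-- analysis; the only arithmetic is that both ways of splitting an index of an iterated
-- composite into blocks agree.  Lower triangularity of A is what makes the zero blocks of
-- the matrix definition agree with the substitution, and antisymmetry at i is what keeps
-- the substitution transitive.
module Submission where

open import Defs
open import Data.Bool using (Bool; true; false)
open import Data.Fin using (Fin; toℕ; fromℕ<; cast; zero)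
open import Data.Fin.Properties using (toℕ<n; toℕ-fromℕ<; fromℕ<-toℕ; toℕ-cast)
open import Data.Nat using (ℕ; suc; _+_; _∸_; _<_; _≤_; z≤n; s≤s)
open import Data.Nat.Properties
open import Algebra.Properties.CommutativeSemigroup +-commutativeSemigroup using (xy∙z≈xz∙y)
open import Data.Product using (_×_; _,_; proj₁)
open import Data.Sum using (_⊎_; inj₁; inj₂; [_,_]′; map; map₁; map₂; swap; assocʳ; assocˡ)
open import Data.Sum.Properties using (inj₁-injective)
open import Function using (id; const; _∘_; _on_)
open import Relation.Binary.Definitions using (tri<; tri≈; tri>)
open import Relation.Binary.PropositionalEquality
  using (_≡_; _≢_; refl; sym; trans; cong; cong₂; subst; subst₂; module ≡-Reasoning)
open import Relation.Nullary using (yes; no; contradiction)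

variable
  I I′ J J′ K : Set

collapse : I → I ⊎ J → I
collapse i = [ id , const i ]′

-- inj₁ i is a junk index: the point i itself has been replaced by J.  No composite index
-- is sent to it, and transitivity fails through it (see substitute-trans).
substitute : (I → I → Bool) → I → (J → J → Bool) → I ⊎ J → I ⊎ J → Bool
substitute a i b (inj₂ x) (inj₂ y) = b x y
substitute a i b p        q        = a (collapse i p) (collapse i q)

exchange : (I ⊎ J) ⊎ K → (I ⊎ K) ⊎ J
exchange = assocˡ ∘ map₂ swap ∘ assocʳ

module _ {a a′ : I → I → Bool} {b b′ : J → J → Bool} {i : I} where

  substitute-cong : (∀ x y → a x y ≡ a′ x y) → (∀ x y → b x y ≡ b′ x y) →
                    ∀ p q → substitute a i b p q ≡ substitute a′ i b′ p q
  substitute-cong ea eb (inj₁ x) (inj₁ y) = ea x y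
  substitute-cong ea eb (inj₁ x) (inj₂ y) = ea x i
  substitute-cong ea eb (inj₂ x) (inj₁ y) = ea i y
  substitute-cong ea eb (inj₂ x) (inj₂ y) = eb x y

substitute-reindex : ∀ (a : I → I → Bool) (f : I′ → I) i (b : J → J → Bool) (g : J′ → J) p q →
  substitute (a on f) i (b on g) p q ≡ substitute a (f i) b (map f g p) (map f g q)
substitute-reindex a f i b g (inj₁ x) (inj₁ y) = refl
substitute-reindex a f i b g (inj₁ x) (inj₂ y) = refl
substitute-reindex a f i b g (inj₂ x) (inj₁ y) = refl
substitute-reindex a f i b g (inj₂ x) (inj₂ y) = refl

module _ (a : I → I → Bool) (i : I) (b : J → J → Bool) where

  substitute-inj₁ʳ : ∀ p y → substitute a i b p (inj₁ y) ≡ a (collapse i p) y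
  substitute-inj₁ʳ (inj₁ x) y = refl
  substitute-inj₁ʳ (inj₂ x) y = refl

  substitute-assoc : ∀ j (c : K → K → Bool) p q →
    substitute (substitute a i b) (inj₂ j) c p q
      ≡ substitute a i (substitute b j c) (assocʳ p) (assocʳ q)
  substitute-assoc j c (inj₁ (inj₁ x)) (inj₁ (inj₁ y)) = refl
  substitute-assoc j c (inj₁ (inj₁ x)) (inj₁ (inj₂ y)) = refl
  substitute-assoc j c (inj₁ (inj₁ x)) (inj₂ y)        = refl
  substitute-assoc j c (inj₁ (inj₂ x)) (inj₁ (inj₁ y)) = refl
  substitute-assoc j c (inj₁ (inj₂ x)) (inj₁ (inj₂ y)) = refl
  substitute-assoc j c (inj₁ (inj₂ x)) (inj₂ y)        = refl
  substitute-assoc j c (inj₂ x)        (inj₁ (inj₁ y)) = refl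
  substitute-assoc j c (inj₂ x)        (inj₁ (inj₂ y)) = refl
  substitute-assoc j c (inj₂ x)        (inj₂ y)        = refl

  substitute-exchange : ∀ j (c : K → K → Bool) p q →
    substitute (substitute a i b) (inj₁ j) c p q
      ≡ substitute (substitute a j c) (inj₁ i) b (exchange p) (exchange q)
  substitute-exchange j c (inj₁ (inj₁ x)) (inj₁ (inj₁ y)) = refl
  substitute-exchange j c (inj₁ (inj₁ x)) (inj₁ (inj₂ y)) = refl
  substitute-exchange j c (inj₁ (inj₁ x)) (inj₂ y)        = refl
  substitute-exchange j c (inj₁ (inj₂ x)) (inj₁ (inj₁ y)) = refl
  substitute-exchange j c (inj₁ (inj₂ x)) (inj₁ (inj₂ y)) = refl
  substitute-exchange j c (inj₁ (inj₂ x)) (inj₂ y)        = refl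
  substitute-exchange j c (inj₂ x)        (inj₁ (inj₁ y)) = refl
  substitute-exchange j c (inj₂ x)        (inj₁ (inj₂ y)) = refl
  substitute-exchange j c (inj₂ x)        (inj₂ y)        = refl

  substitute-trans : (∀ {x y z} → a x y ≡ true → a y z ≡ true → a x z ≡ true) →
                     (∀ {x y z} → b x y ≡ true → b y z ≡ true → b x z ≡ true) →
                     (∀ {y} → a i y ≡ true → a y i ≡ true → i ≡ y) →
                     ∀ p q r → q ≢ inj₁ i →
                     substitute a i b p q ≡ true → substitute a i b q r ≡ true →
                     substitute a i b p r ≡ true
  substitute-trans trans-a trans-b antisym (inj₁ x) (inj₁ y) (inj₁ z) _ = trans-a
  substitute-trans trans-a trans-b antisym (inj₁ x) (inj₁ y) (inj₂ z) _ = trans-a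
  substitute-trans trans-a trans-b antisym (inj₁ x) (inj₂ y) (inj₁ z) _ = trans-a
  substitute-trans trans-a trans-b antisym (inj₁ x) (inj₂ y) (inj₂ z) _ = λ e _ → e
  substitute-trans trans-a trans-b antisym (inj₂ x) (inj₁ y) (inj₁ z) _ = trans-a
  substitute-trans trans-a trans-b antisym (inj₂ x) (inj₁ y) (inj₂ z) q≢i =
    λ e₁ e₂ → contradiction (cong inj₁ (sym (antisym e₁ e₂))) q≢i
  substitute-trans trans-a trans-b antisym (inj₂ x) (inj₂ y) (inj₁ z) _ = λ _ e → e
  substitute-trans trans-a trans-b antisym (inj₂ x) (inj₂ y) (inj₂ z) _ = trans-b

-- The counterpart over ℕ of classify: an index of the top or bottom block is sent to its
-- index in A, one of the middle block to its index in B.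
split : ℕ → ℕ → ℕ → ℕ ⊎ ℕ
split i m s with s <? i
... | yes _ = inj₁ s
... | no _ with s ∸ i <? suc m
...   | yes _ = inj₂ (s ∸ i)
...   | no _  = inj₁ (s ∸ m)

<-∸-gap : ∀ {i m s} → i ≤ s → m < s ∸ i → i < s ∸ m
<-∸-gap {i} {m} {s} i≤s m<s∸i =
  m+n≤o⇒m≤o∸n (suc i) (subst (_< s) (+-comm m i) (m≤o∸n⇒m+n≤o (suc m) i≤s m<s∸i))

module _ {i m : ℕ} where

  split-below : ∀ {s} → s < i → split i m s ≡ inj₁ s
  split-below {s} s<i with s <? i
  ... | yes _   = refl
  ... | no s≮i = contradiction s<i s≮i

  split-inside : ∀ {x} → x ≤ m → split i m (i + x) ≡ inj₂ x
  split-inside {x} x≤m with i + x <? i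
  ... | yes i+x<i = contradiction i+x<i (m+n≮m i x)
  ... | no _ with i + x ∸ i <? suc m
  ...   | yes _ = cong inj₂ (m+n∸m≡n i x)
  ...   | no ≮ = contradiction (s≤s (subst (_≤ m) (sym (m+n∸m≡n i x)) x≤m)) ≮

  split-above : ∀ {x} → i < x → split i m (x + m) ≡ inj₁ x
  split-above {x} i<x with x + m <? i
  ... | yes x+m<i = contradiction (≤-<-trans (m≤m+n x m) x+m<i) (<-asym i<x)
  ... | no _ with x + m ∸ i <? suc m
  ...   | yes x+m∸i<1+m = contradiction (≤-pred x+m∸i<1+m) (<⇒≱ m<x+m∸i)
    where
    m<x+m∸i = m+n≤o⇒m≤o∸n (suc m) (subst (_< x + m) (+-comm i m) (+-monoˡ-< m i<x))
  ...   | no _ = cong inj₁ (m+n∸n≡m x m)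

data Split (i m : ℕ) : ℕ → Set where
  below  : ∀ {s} → s < i → Split i m s
  inside : ∀ {x} → x ≤ m → Split i m (i + x)
  above  : ∀ {x} → i < x → Split i m (x + m)

split-view : ∀ i m s → Split i m s
split-view i m s with s <? i
... | yes s<i = below s<i
... | no s≮i with s ∸ i <? suc m
...   | yes s∸i<1+m = subst (Split i m) (m+[n∸m]≡n (≮⇒≥ s≮i)) (inside (≤-pred s∸i<1+m))
...   | no s∸i≮1+m  = subst (Split i m) (m∸n+n≡m m≤s) (above (<-∸-gap (≮⇒≥ s≮i) m<s∸i))
  where
  m<s∸i = ≮⇒≥ s∸i≮1+m
  m≤s = ≤-trans (<⇒≤ m<s∸i) (m∸n≤m s i)

viewed : ∀ {i m s} → Split i m s → ℕ ⊎ ℕ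
viewed (below {s} _)  = inj₁ s
viewed (inside {x} _) = inj₂ x
viewed (above {x} _)  = inj₁ x

split-viewed : ∀ {i m s} (v : Split i m s) → split i m s ≡ viewed v
split-viewed {i} {m} (below s<i)  = split-below {i} {m} s<i
split-viewed {i} {m} (inside x≤m) = split-inside {i} {m} x≤m
split-viewed {i} {m} (above i<x)  = split-above {i} {m} i<x

split-beyond : ∀ {i m n s} → i < n → n + m ≤ s → split i m s ≡ inj₁ (s ∸ m)
split-beyond {i} {m} {n} {s} i<n n+m≤s =
  trans (cong (split i m) (sym (m∸n+n≡m (m+n≤o⇒n≤o n n+m≤s))))
        (split-above (<-≤-trans i<n (m+n≤o⇒m≤o∸n n n+m≤s)))

split-≢-point : ∀ i m s → split i m s ≢ inj₁ i
split-≢-point i m s rewrite split-viewed (split-view i m s) = viewed-≢ (split-view i m s)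
  where
  viewed-≢ : ∀ {s} (v : Split i m s) → viewed v ≢ inj₁ i
  viewed-≢ (below s<i) eq = <-irrefl (inj₁-injective eq) s<i
  viewed-≢ (inside _)  ()
  viewed-≢ (above i<x) eq = <-irrefl (sym (inj₁-injective eq)) i<x

split-zero : ∀ i s → (s ≡ i × split i 0 s ≡ inj₂ 0) ⊎ split i 0 s ≡ inj₁ s
split-zero i s with split-view i 0 s
... | below s<i       = inj₂ (split-below s<i)
... | inside z≤n      = inj₁ (+-identityʳ i , split-inside {i} {0} z≤n)
... | above {x} i<x   = inj₂ (trans (split-above {i} {0} i<x) (cong inj₁ (sym (+-identityʳ x))))

split-assoc : ∀ i j m k → j ≤ m → ∀ s →
  assocʳ (map₁ (split i m) (split (i + j) k s)) ≡ map₂ (split j k) (split i (m + k) s)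
split-assoc i j m k j≤m s with split-view i (m + k) s
... | below s<i
  rewrite split-below {i + j} {k} (<-≤-trans s<i (m≤m+n i j)) | split-below {i} {m} s<i
        | split-below {i} {m + k} s<i = refl
... | inside {x} x≤m+k with split-view j k x
...   | below x<j
  rewrite split-inside {i} {m + k} x≤m+k | split-below {i + j} {k} (+-monoʳ-< i x<j)
        | split-inside {i} {m} (≤-trans (<⇒≤ x<j) j≤m) | split-below {j} {k} x<j = refl
...   | inside {y} y≤k
  rewrite split-inside {i} {m + k} x≤m+k | split-inside {j} {k} y≤k | sym (+-assoc i j y)
        | split-inside {i + j} {k} y≤k = refl
...   | above {y} j<y
  rewrite split-inside {i} {m + k} x≤m+k | split-above {j} {k} j<y | sym (+-assoc i y k)
        | split-above {i + j} {k} (+-monoʳ-< i j<y)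
        | split-inside {i} {m} (+-cancelʳ-≤ k y m x≤m+k) = refl
split-assoc i j m k j≤m s | above {x} i<x
  rewrite split-above {i} {m + k} i<x | sym (+-assoc x m k)
        | split-above {i + j} {k} (+-mono-<-≤ i<x j≤m) | split-above {i} {m} i<x = refl

split-exchange : ∀ i j m k → i < j → ∀ s →
  exchange (map₁ (split i m) (split (j + m) k s)) ≡ map₁ (split j k) (split i m s)
split-exchange i j m k i<j s with split-view i m s
... | below s<i
  rewrite split-below {j + m} {k} (<-≤-trans (<-trans s<i i<j) (m≤m+n j m))
        | split-below {i} {m} s<i | split-below {j} {k} (<-trans s<i i<j) = refl
... | inside x≤m
  rewrite split-below {j + m} {k} (+-mono-<-≤ i<j x≤m) | split-inside {i} {m} x≤m = refl
... | above {x} i<x with split-view j k x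
...   | below x<j
  rewrite split-below {j + m} {k} (+-monoˡ-< m x<j) | split-above {i} {m} i<x
        | split-below {j} {k} x<j = refl
...   | inside {y} y≤k
  rewrite split-above {i} {m} i<x | split-inside {j} {k} y≤k | xy∙z≈xz∙y j y m
        | split-inside {j + m} {k} y≤k = refl
...   | above {y} j<y
  rewrite split-above {i} {m} i<x | split-above {j} {k} j<y | xy∙z≈xz∙y y k m
        | split-above {j + m} {k} (+-monoˡ-< m j<y) | split-above {i} {m} (<-trans i<j j<y) = refl

compose : (ℕ → ℕ → Bool) → ℕ → ℕ → (ℕ → ℕ → Bool) → ℕ → ℕ → Bool
compose a i m b = substitute a i b on split i m

compose-congˡ : ∀ {a a′ : ℕ → ℕ → Bool} i m b → (∀ x y → a x y ≡ a′ x y) →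
                ∀ s t → compose a i m b s t ≡ compose a′ i m b s t
compose-congˡ i m b ea s t = substitute-cong ea (λ _ _ → refl) (split i m s) (split i m t)

compose-congʳ : ∀ (a : ℕ → ℕ → Bool) i m {b b′} → (∀ x y → b x y ≡ b′ x y) →
                ∀ s t → compose a i m b s t ≡ compose a i m b′ s t
compose-congʳ a i m eb s t = substitute-cong (λ _ _ → refl) eb (split i m s) (split i m t)

LowerTriangular : (ℕ → ℕ → Bool) → Set
LowerTriangular a = ∀ {x y} → x < y → a x y ≡ false

Transitive : (ℕ → ℕ → Bool) → Set
Transitive a = ∀ x y z → a x y ≡ true → a y z ≡ true → a x z ≡ true

compose-lower : ∀ {a b} i m → LowerTriangular a → LowerTriangular b →
                LowerTriangular (compose a i m b)
compose-lower {a} {b} i m lower-a lower-b {s} {t} s<t =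
  trans (cong₂ (substitute a i b) (split-viewed (split-view i m s)) (split-viewed (split-view i m t)))
        (by-blocks (split-view i m s) (split-view i m t) s<t)
  where
  by-blocks : ∀ {s t} (u : Split i m s) (v : Split i m t) → s < t →
              substitute a i b (viewed u) (viewed v) ≡ false
  by-blocks (below s<i)   (below _)     s<t = lower-a s<t
  by-blocks (below s<i)   (inside _)    _   = lower-a s<i
  by-blocks (below s<i)   (above i<y)   _   = lower-a (<-trans s<i i<y)
  by-blocks (inside _)    (below t<i)   s<t = contradiction (<-trans s<t t<i) (m+n≮m i _)
  by-blocks (inside _)    (inside _)    s<t = lower-b (+-cancelˡ-< i _ _ s<t)
  by-blocks (inside _)    (above i<y)   _   = lower-a i<y
  by-blocks (above i<x)   (below t<i)   s<t = contradiction (<-trans (<-trans s<t t<i) i<x) (m+n≮m _ m)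
  by-blocks (above i<x)   (inside y≤m)  s<t =
    contradiction (<-≤-trans s<t (≤-trans (+-monoʳ-≤ i y≤m) (<⇒≤ (+-monoˡ-< m i<x)))) (n≮n _)
  by-blocks (above _)     (above _)     s<t = lower-a (+-cancelʳ-< m _ _ s<t)

lower-antisym : ∀ {a} → LowerTriangular a → ∀ {x y} → a x y ≡ true → a y x ≡ true → x ≡ y
lower-antisym lower {x} {y} xy yx with <-cmp x y
... | tri< x<y _ _ = contradiction (trans (sym xy) (lower x<y)) λ ()
... | tri≈ _ x≡y _ = x≡y
... | tri> _ _ y<x = contradiction (trans (sym yx) (lower y<x)) λ ()

compose-trans : ∀ {a b} i m → LowerTriangular a → Transitive a → Transitive b →
                Transitive (compose a i m b)
compose-trans {a} {b} i m lower-a trans-a trans-b s t u =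
  substitute-trans a i b (trans-a _ _ _) (trans-b _ _ _) (lower-antisym lower-a)
                   (split i m s) (split i m t) (split i m u) (split-≢-point i m t)

module _ (a b c : ℕ → ℕ → Bool) where
  open ≡-Reasoning

  compose-assoc : ∀ i j m k → j ≤ m → ∀ s t →
    compose (compose a i m b) (i + j) k c s t ≡ compose a i (m + k) (compose b j k c) s t
  compose-assoc i j m k j≤m s t = begin
    substitute (substitute a i b on split i m) (i + j) c p q
      ≡⟨ substitute-reindex (substitute a i b) (split i m) (i + j) c id p q ⟩
    substitute (substitute a i b) (split i m (i + j)) c (map₁ (split i m) p) (map₁ (split i m) q)
      ≡⟨ cong (λ ι → substitute (substitute a i b) ι c (map₁ (split i m) p) (map₁ (split i m) q))
              (split-inside {i} {m} j≤m) ⟩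
    substitute (substitute a i b) (inj₂ j) c (map₁ (split i m) p) (map₁ (split i m) q)
      ≡⟨ substitute-assoc a i b j c (map₁ (split i m) p) (map₁ (split i m) q) ⟩
    substitute a i (substitute b j c) (assocʳ (map₁ (split i m) p)) (assocʳ (map₁ (split i m) q))
      ≡⟨ cong₂ (substitute a i (substitute b j c))
              (split-assoc i j m k j≤m s) (split-assoc i j m k j≤m t) ⟩
    substitute a i (substitute b j c) (map₂ (split j k) p′) (map₂ (split j k) q′)
      ≡⟨ substitute-reindex a id i (substitute b j c) (split j k) p′ q′ ⟨
    substitute a i (substitute b j c on split j k) p′ q′ ∎
    where
    p = split (i + j) k s
    q = split (i + j) k t
    p′ = split i (m + k) s
    q′ = split i (m + k) t

  compose-exchange : ∀ i j m k → i < j → ∀ s t →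
    compose (compose a i m b) (j + m) k c s t ≡ compose (compose a j k c) i m b s t
  compose-exchange i j m k i<j s t = begin
    substitute (substitute a i b on split i m) (j + m) c p q
      ≡⟨ substitute-reindex (substitute a i b) (split i m) (j + m) c id p q ⟩
    substitute (substitute a i b) (split i m (j + m)) c (map₁ (split i m) p) (map₁ (split i m) q)
      ≡⟨ cong (λ ι → substitute (substitute a i b) ι c (map₁ (split i m) p) (map₁ (split i m) q))
              (split-above {i} {m} i<j) ⟩
    substitute (substitute a i b) (inj₁ j) c (map₁ (split i m) p) (map₁ (split i m) q)
      ≡⟨ substitute-exchange a i b j c (map₁ (split i m) p) (map₁ (split i m) q) ⟩
    substitute (substitute a j c) (inj₁ i) b (exchange (map₁ (split i m) p))
                                             (exchange (map₁ (split i m) q))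
      ≡⟨ cong₂ (substitute (substitute a j c) (inj₁ i) b)
               (split-exchange i j m k i<j s) (split-exchange i j m k i<j t) ⟩
    substitute (substitute a j c) (inj₁ i) b (map₁ (split j k) p′) (map₁ (split j k) q′)
      ≡⟨ cong (λ ι → substitute (substitute a j c) ι b (map₁ (split j k) p′) (map₁ (split j k) q′))
              (split-below {j} {k} i<j) ⟨
    substitute (substitute a j c) (split j k i) b (map₁ (split j k) p′) (map₁ (split j k) q′)
      ≡⟨ substitute-reindex (substitute a j c) (split j k) i b id p′ q′ ⟨
    substitute (substitute a j c on split j k) i b p′ q′ ∎
    where
    p = split (j + m) k s
    q = split (j + m) k t
    p′ = split i m s
    q′ = split i m t

compose-identityˡ : ∀ (a b : ℕ → ℕ → Bool) {n s t} → s ≤ n → t ≤ n → compose a 0 n b s t ≡ b s t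
compose-identityˡ a b {n} s≤n t≤n =
  cong₂ (substitute a 0 b) (split-inside {0} {n} s≤n) (split-inside {0} {n} t≤n)

compose-identityʳ : ∀ (a : ℕ → ℕ → Bool) i b → b 0 0 ≡ a i i → ∀ s t → compose a i 0 b s t ≡ a s t
compose-identityʳ a i b b00≡aii s t with split-zero i s | split-zero i t
... | inj₁ (refl , ps) | inj₁ (refl , pt) = trans (cong₂ (substitute a i b) ps pt) b00≡aii
... | inj₁ (refl , ps) | inj₂ pt          = cong₂ (substitute a i b) ps pt
... | inj₂ ps          | inj₁ (refl , pt) = cong₂ (substitute a i b) ps pt
... | inj₂ ps          | inj₂ pt          = cong₂ (substitute a i b) ps pt

IsLowerTriangular : ∀ {n} → Mat n → Set
IsLowerTriangular {n} A = ∀ (s t : Fin n) → toℕ s < toℕ t → A s t ≡ false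

lift : ∀ {n} → Mat n → ℕ → ℕ → Bool
lift {n} A s t with s <? n | t <? n
... | yes s<n | yes t<n = A (fromℕ< s<n) (fromℕ< t<n)
... | _       | _       = false

module _ {n} (A : Mat n) where

  lift-toℕ : ∀ s t → lift A (toℕ s) (toℕ t) ≡ A s t
  lift-toℕ s t with toℕ s <? n | toℕ t <? n
  ... | yes s<n | yes t<n = cong₂ A (fromℕ<-toℕ s s<n) (fromℕ<-toℕ t t<n)
  ... | yes _   | no t≮n  = contradiction (toℕ<n t) t≮n
  ... | no s≮n  | _       = contradiction (toℕ<n s) s≮n

  lift-vanishes : IsLowerTriangular A → ∀ s t → toℕ s < toℕ t → lift A (toℕ s) (toℕ t) ≡ false
  lift-vanishes lower s t s<t = trans (lift-toℕ s t) (lower s t s<t)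

  lift-outsideˡ : ∀ {s} t → n ≤ s → lift A s t ≡ false
  lift-outsideˡ {s} t n≤s with s <? n | t <? n
  ... | yes s<n | yes _ = contradiction s<n (≤⇒≯ n≤s)
  ... | yes _   | no _  = refl
  ... | no _    | _     = refl

  lift-outsideʳ : ∀ s {t} → n ≤ t → lift A s t ≡ false
  lift-outsideʳ s {t} n≤t with s <? n | t <? n
  ... | yes _ | yes t<n = contradiction t<n (≤⇒≯ n≤t)
  ... | yes _ | no _    = refl
  ... | no _  | _       = refl

  lift-lower : IsLowerTriangular A → LowerTriangular (lift A)
  lift-lower lower {s} {t} s<t with s <? n | t <? n
  ... | yes s<n | yes t<n = lower _ _ (subst₂ _<_ (sym (toℕ-fromℕ< s<n)) (sym (toℕ-fromℕ< t<n)) s<t)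
  ... | yes _   | no _    = refl
  ... | no _    | _       = refl

  lift-trans : (∀ s t u → A s t ≡ true → A t u ≡ true → A s u ≡ true) → Transitive (lift A)
  lift-trans trans-A s t u st tu with s <? n | t <? n | u <? n
  ... | yes _ | yes _ | yes _ = trans-A _ _ _ st tu
  ... | yes _ | yes _ | no _  = tu
  ... | yes _ | no _  | _     = contradiction st λ ()
  ... | no _  | _     | _     = st

data Shadow {n m} (i : Fin n) : Pos n m → ℕ ⊎ ℕ → Set where
  in-top : ∀ {a} → toℕ a < toℕ i → Shadow i (top a) (inj₁ (toℕ a))
  in-mid : ∀ {x} → Shadow i (mid x) (inj₂ (toℕ x))
  in-bot : ∀ {a} → toℕ i < toℕ a → Shadow i (bot a) (inj₁ (toℕ a))

classify-shadow : ∀ {n m} (i : Fin n) (s : Fin (n + m)) →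
                  Shadow i (classify i s) (split (toℕ i) m (toℕ s))
classify-shadow {n} {m} i s with toℕ s <? toℕ i
... | yes s<i = subst (Shadow i _) (cong inj₁ (toℕ-fromℕ< _))
                      (in-top (subst (_< toℕ i) (sym (toℕ-fromℕ< _)) s<i))
... | no s≮i with toℕ s ∸ toℕ i <? suc m
...   | yes _ = subst (Shadow i _) (cong inj₂ (toℕ-fromℕ< _)) in-mid
...   | no s∸i≮1+m = subst (Shadow i _) (cong inj₁ (toℕ-fromℕ< _))
                           (in-bot (subst (toℕ i <_) (sym (toℕ-fromℕ< _)) i<s∸m))
  where
  i<s∸m = <-∸-gap (≮⇒≥ s≮i) (≮⇒≥ s∸i≮1+m)

module _ {n m} {A : Mat n} (lower-A : IsLowerTriangular A) (B : Mat (suc m)) (i : Fin n) where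

  □-compose : ∀ s t → (A □⟨ i ⟩ B) s t ≡ compose (lift A) (toℕ i) m (lift B) (toℕ s) (toℕ t)
  □-compose s t
    with classify i s | split (toℕ i) m (toℕ s) | classify-shadow {m = m} i s
       | classify i t | split (toℕ i) m (toℕ t) | classify-shadow {m = m} i t
  ... | top a | _ | in-top _   | top b | _ | in-top _   = sym (lift-toℕ A a b)
  ... | top a | _ | in-top a<i | mid _ | _ | in-mid     = sym (lift-vanishes A lower-A a i a<i)
  ... | top a | _ | in-top a<i | bot b | _ | in-bot i<b =
    sym (lift-vanishes A lower-A a b (<-trans a<i i<b))
  ... | mid _ | _ | in-mid     | top b | _ | in-top _   = sym (lift-toℕ A i b)
  ... | mid x | _ | in-mid     | mid y | _ | in-mid     = sym (lift-toℕ B x y)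
  ... | mid _ | _ | in-mid     | bot b | _ | in-bot i<b = sym (lift-vanishes A lower-A i b i<b)
  ... | bot a | _ | in-bot _   | top b | _ | in-top _   = sym (lift-toℕ A a b)
  ... | bot a | _ | in-bot _   | mid _ | _ | in-mid     = sym (lift-toℕ A a i)
  ... | bot a | _ | in-bot _   | bot b | _ | in-bot _   = sym (lift-toℕ A a b)

  -- Indices beyond the range fall into the bottom block, so both sides vanish there.
  lift-□ : ∀ s t → lift (A □⟨ i ⟩ B) s t ≡ compose (lift A) (toℕ i) m (lift B) s t
  lift-□ s t with s <? n + m | t <? n + m
  ... | yes s< | yes t< =
    trans (□-compose (fromℕ< s<) (fromℕ< t<))
          (cong₂ (compose (lift A) (toℕ i) m (lift B)) (toℕ-fromℕ< s<) (toℕ-fromℕ< t<))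
  ... | yes _ | no t≮ = sym (begin
    substitute (lift A) (toℕ i) (lift B) (split (toℕ i) m s) (split (toℕ i) m t)
      ≡⟨ cong (substitute (lift A) (toℕ i) (lift B) (split (toℕ i) m s))
              (split-beyond (toℕ<n i) (≮⇒≥ t≮)) ⟩
    substitute (lift A) (toℕ i) (lift B) (split (toℕ i) m s) (inj₁ (t ∸ m))
      ≡⟨ substitute-inj₁ʳ (lift A) (toℕ i) (lift B) (split (toℕ i) m s) (t ∸ m) ⟩
    lift A _ (t ∸ m)
      ≡⟨ lift-outsideʳ A _ (m+n≤o⇒m≤o∸n n (≮⇒≥ t≮)) ⟩
    false ∎)
    where open ≡-Reasoning
  ... | no s≮ | _ = sym (begin
    substitute (lift A) (toℕ i) (lift B) (split (toℕ i) m s) (split (toℕ i) m t)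
      ≡⟨ cong (λ p → substitute (lift A) (toℕ i) (lift B) p (split (toℕ i) m t))
              (split-beyond (toℕ<n i) (≮⇒≥ s≮)) ⟩
    lift A (s ∸ m) _
      ≡⟨ lift-outsideˡ A _ (m+n≤o⇒m≤o∸n n (≮⇒≥ s≮)) ⟩
    false ∎)
    where open ≡-Reasoning

toℕ-idxB : ∀ {n m} (i : Fin n) (j : Fin (suc m)) → toℕ (idxB i j) ≡ toℕ i + toℕ j
toℕ-idxB i j = toℕ-fromℕ< _

toℕ-idxC : ∀ {n} m (j : Fin n) → toℕ (idxC m j) ≡ toℕ j + m
toℕ-idxC m j = toℕ-fromℕ< _

toℕ-idxI : ∀ {n} k (i : Fin n) → toℕ (idxI k i) ≡ toℕ i
toℕ-idxI k i = toℕ-fromℕ< _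

□-lower : ∀ {n m} {A : Mat n} {B : Mat (suc m)} {i : Fin n} →
          IsLowerTriangular A → IsLowerTriangular B → IsLowerTriangular (A □⟨ i ⟩ B)
□-lower {m = m} {A} {B} {i} lower-A lower-B s t s<t =
  trans (□-compose lower-A B i s t)
        (compose-lower (toℕ i) m (lift-lower A lower-A) (lift-lower B lower-B) s<t)

□-isPosetMatrix : ∀ {n m} (A : Mat n) (B : Mat (suc m)) (i : Fin n) →
                  IsPosetMatrix A → IsPosetMatrix B → IsPosetMatrix (A □⟨ i ⟩ B)
□-isPosetMatrix {m = m} A B i (lower-A , refl-A , trans-A) (lower-B , refl-B , trans-B) =
  □-lower {i = i} lower-A lower-B , reflexive , transitive
  where
  reflexive : ∀ s → (A □⟨ i ⟩ B) s s ≡ true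
  reflexive s with classify i s
  ... | top a = refl-A a
  ... | mid x = refl-B x
  ... | bot a = refl-A a

  transitive : ∀ s t u → (A □⟨ i ⟩ B) s t ≡ true → (A □⟨ i ⟩ B) t u ≡ true → (A □⟨ i ⟩ B) s u ≡ true
  transitive s t u st tu =
    trans (□-compose lower-A B i s u)
          (compose-trans {lift A} {lift B} (toℕ i) m
                         (lift-lower A lower-A) (lift-trans A trans-A) (lift-trans B trans-B)
                         (toℕ s) (toℕ t) (toℕ u)
                         (trans (sym (□-compose lower-A B i s t)) st)
                         (trans (sym (□-compose lower-A B i t u)) tu))

≋-from-lift : ∀ {n n′} {A : Mat n} (e : n ≡ n′) (A′ : Mat n′) →
              (∀ s t → A s t ≡ lift A′ (toℕ s) (toℕ t)) → A ≋⟨ e ⟩ A′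
≋-from-lift e A′ eq s t =
  trans (eq s t) (trans (sym (cong₂ (lift A′) (toℕ-cast e s) (toℕ-cast e t)))
                        (lift-toℕ A′ (cast e s) (cast e t)))

module _ {n m k} {A : Mat n} {B : Mat (suc m)} {C : Mat (suc k)}
         (lower-A : IsLowerTriangular A) (lower-B : IsLowerTriangular B) where
  open ≡-Reasoning

  □-assoc : ∀ i j → ((A □⟨ i ⟩ B) □⟨ idxB i j ⟩ C) ≋⟨ sizeAssoc n m k ⟩ (A □⟨ i ⟩ (B □⟨ j ⟩ C))
  □-assoc i j = ≋-from-lift (sizeAssoc n m k) (A □⟨ i ⟩ (B □⟨ j ⟩ C)) λ s t → begin
    ((A □⟨ i ⟩ B) □⟨ idxB i j ⟩ C) s t
      ≡⟨ □-compose (□-lower {i = i} lower-A lower-B) C (idxB i j) s t ⟩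
    compose (lift (A □⟨ i ⟩ B)) (toℕ (idxB i j)) k c (toℕ s) (toℕ t)
      ≡⟨ compose-congˡ (toℕ (idxB i j)) k c (lift-□ lower-A B i) (toℕ s) (toℕ t) ⟩
    compose (compose a (toℕ i) m b) (toℕ (idxB i j)) k c (toℕ s) (toℕ t)
      ≡⟨ cong (λ ι → compose (compose a (toℕ i) m b) ι k c (toℕ s) (toℕ t)) (toℕ-idxB i j) ⟩
    compose (compose a (toℕ i) m b) (toℕ i + toℕ j) k c (toℕ s) (toℕ t)
      ≡⟨ compose-assoc a b c (toℕ i) (toℕ j) m k (≤-pred (toℕ<n j)) (toℕ s) (toℕ t) ⟩
    compose a (toℕ i) (m + k) (compose b (toℕ j) k c) (toℕ s) (toℕ t)
      ≡⟨ compose-congʳ a (toℕ i) (m + k) (lift-□ lower-B C j) (toℕ s) (toℕ t) ⟨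
    compose a (toℕ i) (m + k) (lift (B □⟨ j ⟩ C)) (toℕ s) (toℕ t)
      ≡⟨ lift-□ lower-A (B □⟨ j ⟩ C) i (toℕ s) (toℕ t) ⟨
    lift (A □⟨ i ⟩ (B □⟨ j ⟩ C)) (toℕ s) (toℕ t) ∎
    where
    a = lift A
    b = lift B
    c = lift C

  □-exchange : IsLowerTriangular C → ∀ i j → toℕ i < toℕ j →
               ((A □⟨ i ⟩ B) □⟨ idxC m j ⟩ C) ≋⟨ sizeComm n m k ⟩ ((A □⟨ j ⟩ C) □⟨ idxI k i ⟩ B)
  □-exchange lower-C i j i<j =
   ≋-from-lift (sizeComm n m k) ((A □⟨ j ⟩ C) □⟨ idxI k i ⟩ B) λ s t → begin
    ((A □⟨ i ⟩ B) □⟨ idxC m j ⟩ C) s t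
      ≡⟨ □-compose (□-lower {i = i} lower-A lower-B) C (idxC m j) s t ⟩
    compose (lift (A □⟨ i ⟩ B)) (toℕ (idxC m j)) k c (toℕ s) (toℕ t)
      ≡⟨ compose-congˡ (toℕ (idxC m j)) k c (lift-□ lower-A B i) (toℕ s) (toℕ t) ⟩
    compose (compose a (toℕ i) m b) (toℕ (idxC m j)) k c (toℕ s) (toℕ t)
      ≡⟨ cong (λ ι → compose (compose a (toℕ i) m b) ι k c (toℕ s) (toℕ t)) (toℕ-idxC m j) ⟩
    compose (compose a (toℕ i) m b) (toℕ j + m) k c (toℕ s) (toℕ t)
      ≡⟨ compose-exchange a b c (toℕ i) (toℕ j) m k i<j (toℕ s) (toℕ t) ⟩
    compose (compose a (toℕ j) k c) (toℕ i) m b (toℕ s) (toℕ t)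
      ≡⟨ compose-congˡ (toℕ i) m b (lift-□ lower-A C j) (toℕ s) (toℕ t) ⟨
    compose (lift (A □⟨ j ⟩ C)) (toℕ i) m b (toℕ s) (toℕ t)
      ≡⟨ cong (λ ι → compose (lift (A □⟨ j ⟩ C)) ι m b (toℕ s) (toℕ t)) (toℕ-idxI k i) ⟨
    compose (lift (A □⟨ j ⟩ C)) (toℕ (idxI k i)) m b (toℕ s) (toℕ t)
      ≡⟨ lift-□ (□-lower {i = j} lower-A lower-C) B (idxI k i) (toℕ s) (toℕ t) ⟨
    lift ((A □⟨ j ⟩ C) □⟨ idxI k i ⟩ B) (toℕ s) (toℕ t) ∎
    where
    a = lift A
    b = lift B
    c = lift C

unitMat-lower : IsLowerTriangular unitMat
unitMat-lower zero zero ()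

□-identityˡ : ∀ {n} (A : Mat (suc n)) → (unitMat □⟨ zero ⟩ A) ≋⟨ refl ⟩ A
□-identityˡ A = ≋-from-lift refl A λ s t →
  trans (□-compose unitMat-lower A zero s t)
        (compose-identityˡ (lift unitMat) (lift A) (≤-pred (toℕ<n s)) (≤-pred (toℕ<n t)))

□-identityʳ : ∀ {n} (A : Mat n) (i : Fin n) → IsPosetMatrix A →
              (A □⟨ i ⟩ unitMat) ≋⟨ +-identityʳ n ⟩ A
□-identityʳ {n} A i (lower-A , refl-A , _) = ≋-from-lift (+-identityʳ n) A λ s t →
  trans (□-compose lower-A unitMat i s t)
        (compose-identityʳ (lift A) (toℕ i) (lift unitMat) (sym (trans (lift-toℕ A i i) (refl-A i)))
                           (toℕ s) (toℕ t))

theorem2 :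
  (∀ {n m} (A : Mat n) (B : Mat (suc m)) (i : Fin n) →
     IsPosetMatrix A → IsPosetMatrix B → IsPosetMatrix (A □⟨ i ⟩ B))
  ×
  (∀ {n m k} (A : Mat n) (B : Mat (suc m)) (C : Mat (suc k)) (i : Fin n) (j : Fin (suc m)) →
     IsPosetMatrix A → IsPosetMatrix B → IsPosetMatrix C →
     ((A □⟨ i ⟩ B) □⟨ idxB i j ⟩ C) ≋⟨ sizeAssoc n m k ⟩ (A □⟨ i ⟩ (B □⟨ j ⟩ C)))
  ×
  (∀ {n m k} (A : Mat n) (B : Mat (suc m)) (C : Mat (suc k)) (i j : Fin n) →
     toℕ i < toℕ j →
     IsPosetMatrix A → IsPosetMatrix B → IsPosetMatrix C →
     ((A □⟨ i ⟩ B) □⟨ idxC m j ⟩ C) ≋⟨ sizeComm n m k ⟩ ((A □⟨ j ⟩ C) □⟨ idxI k i ⟩ B))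
  ×
  (∀ {n} (A : Mat (suc n)) → IsPosetMatrix A →
     (unitMat □⟨ zero ⟩ A) ≋⟨ refl ⟩ A)
  ×
  (∀ {n} (A : Mat n) (i : Fin n) → IsPosetMatrix A →
     (A □⟨ i ⟩ unitMat) ≋⟨ +-identityʳ n ⟩ A)
theorem2 =
    □-isPosetMatrix
  , (λ _ _ _ i j PA PB _ → □-assoc (proj₁ PA) (proj₁ PB) i j)
  , (λ _ _ _ i j i<j PA PB PC → □-exchange (proj₁ PA) (proj₁ PB) (proj₁ PC) i j i<j)
  , (λ A _ → □-identityˡ A)
  , □-identityʳ
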